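{- Let $G$ be a digraph and let $\mathbf{n}\in\mathbb{Z}_{\geq 0}^{V}$. Let $H\in\mathscr{A}(\mathbf{n},G)$, and write $H=\{x_s-x_t=w\}$ for some $0\leq w\leq n_t+\varepsilon_G(t,s)$. Then $\mathscr{A}(\mathbf{n},G)^H$ and $\mathscr{A}(\mathbf{n}^{H},G^{H})$ are affinely equivalent. In particular, the class of arrangements $\mathscr{A}(\mathbf{n},G)$ is closed under restriction.
   Context: $\mathbb{K}$ is a field of characteristic zero, $V$ is a finite set with $|V|=\ell\geq 2$, $G=(V,E)$ is a digraph with $E\subseteq\{(i,j)\mid i,j\in V,\ i\neq j\}$, and $\mathbf{n}=(n_i)_{i\in V}\in\mathbb{Z}_{\geq 0}^V$. For $i\neq j$, $\varepsilon_G(i,j)=1$ if $(i,j)\in E$ and $0$ otherwise. The arrangement in $\mathbb{K}^V$ is $\mathscr{A}(\mathbf{n},G)=\{\{x_i-x_j=c\}\mid i,j\in V,\ i\neq j,\ c\in\mathbb{Z},\ -n_i-\varepsilon_G(i,j)\leq c\leq n_j+\varepsilon_G(j,i)\}$; every $H$ in it can be written $H=\{x_s-x_t=w\}$ with $0\leq w\leq n_t+\varepsilon_G(t,s)$. The restriction is $\mathscr{A}^X=\{H'\cap X\mid H'\in\mathscr{A},\ X\not\subseteq H',\ H'\cap X\neq\emptyset\}$. Two arrangements are affinely equivalent if some affine isomorphism of the ambient spaces maps one onto the other. For $H=\{x_s-x_t=w\}$, the contraction $G^H=(V^H,E^H)$ is defined by $V^H=(V\setminus\{s,t\})\cup\{u\}$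 with $u$ a new vertex; for $i\in V^H\setminus\{u\}$: $(i,u)\in E^H$ iff $(i,t)\in E$ when $w>0$, and iff $(i,s)\in E$ or $(i,t)\in E$ when $w=0$; $(u,i)\in E^H$ iff $(s,i)\in E$ when $n_s+w>n_t$, iff $(s,i)\in E$ or $(t,i)\in E$ when $n_s+w=n_t$, and iff $(t,i)\in E$ when $n_s+w<n_t$; for $i,j\in V^H\setminus\{u\}$, $(i,j)\in E^H$ iff $(i,j)\in E$. Also $\mathbf{n}^H=(n^H_i)_{i\in V^H}$ with $n^H_i=n_i$ for $i\neq u$ and $n^H_u=\max\{n_s+w,n_t\}$. -}

module Defs where

open import Level using (Level) renaming (suc to lsuc)
open import Data.Nat as ℕ using (ℕ; zero; suc; _⊔_) renaming (_+_ to _+ℕ_; _≤_ to _≤ℕ_)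
open import Data.Integer as ℤ using (ℤ; +_; -[1+_]) renaming (_≤_ to _≤ℤ_)
open import Data.Bool using (Bool; true; false; _∨_; if_then_else_)
open import Data.Fin using (Fin)
open import Data.Product using (Σ; ∃; _×_; _,_)
open import Relation.Nullary using (¬_)
open import Relation.Binary.PropositionalEquality using (_≡_; _≢_)
open import Algebra.Bundles using (CommutativeRing)

record Field (c ℓ : Level) : Set (lsuc (c Level.⊔ ℓ)) where
  field
    commRing : CommutativeRing c ℓ
  open CommutativeRing commRing public
  field
    1≉0     : ¬ (1# ≈ 0#)
    inverse : ∀ x → ¬ (x ≈ 0#) → ∃ λ y → x * y ≈ 1#

module FieldOps {c ℓ} (K : Field c ℓ) where
  open Field K

  natK : ℕ → Carrier
  natK zero    = 0#
  natK (suc n) = 1# + natK n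

  intK : ℤ → Carrier
  intK (+ n)     = natK n
  intK -[1+ n ]  = - natK (suc n)

  CharZero : Set ℓ
  CharZero = ∀ n → ¬ (natK (suc n) ≈ 0#)

  _≈ᵥ_ : {V : Set} → (V → Carrier) → (V → Carrier) → Set ℓ
  x ≈ᵥ y = ∀ i → x i ≈ y i

  IsLinear : {W V : Set} → ((W → Carrier) → (V → Carrier)) → Set (c Level.⊔ ℓ)
  IsLinear {W} L =
      (∀ (x y : W → Carrier) → x ≈ᵥ y → L x ≈ᵥ L y)
    × (∀ (x y : W → Carrier) → L (λ k → x k + y k) ≈ᵥ (λ i → L x i + L y i))
    × (∀ (a : Carrier) (x : W → Carrier) → L (λ k → a * x k) ≈ᵥ (λ i → a * L x i))

  IsAffine : {W V : Set} → ((W → Carrier) → (V → Carrier)) → Set (c Level.⊔ ℓ)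
  IsAffine {W} {V} φ = Σ (V → Carrier) λ b → IsLinear (λ x i → φ x i - b i)

  -- Hyperplanes {x_i - x_j = c}, described by a triple (i , j , c).

  HP : Set → Set
  HP V = V × V × ℤ

  _∈H_ : {V : Set} → (V → Carrier) → HP V → Set ℓ
  x ∈H (i , j , c) = x i - x j ≈ intK c

  -- H' contributes to the restriction 𝒜^H:  H ⊄ H'  and  H' ∩ H ≠ ∅
  Survives : {V : Set} → HP V → HP V → Set (c Level.⊔ ℓ)
  Survives H H' =
    ¬ (∀ z → z ∈H H → z ∈H H') × ∃ λ z → (z ∈H H) × (z ∈H H')

  Pullback : {W V : Set} → ((W → Carrier) → (V → Carrier)) → HP W → HP V → Set (c Level.⊔ ℓ)
  Pullback φ H'' H' = ∀ y → (y ∈H H'' → φ y ∈H H') × (φ y ∈H H' → y ∈H H'')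

-- Digraphs on V: edge indicator e : V → V → Bool (loops are irrelevant,
-- since only pairs i ≠ j are ever consulted).

ε : {V : Set} → (V → V → Bool) → V → V → ℕ
ε e i j = if e i j then 1 else 0

InArr : {V : Set} → (V → ℕ) → (V → V → Bool) → V × V × ℤ → Set
InArr n e (i , j , c) =
  (i ≢ j) × (ℤ.- (+ (n i +ℕ ε e i j)) ≤ℤ c) × (c ≤ℤ + (n j +ℕ ε e j i))

data VH {ℓ : ℕ} (s t : Fin ℓ) : Set where
  u   : VH s t
  old : (i : Fin ℓ) → .(i ≢ s) → .(i ≢ t) → VH s t

data Cmp : Set where gt eq lt : Cmp

cmp : ℕ → ℕ → Cmp
cmp zero    zero    = eq
cmp zero    (suc _) = lt
cmp (suc _) zero    = gt
cmp (suc a) (suc b) = cmp a b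

module Contraction {ℓ : ℕ} (n : Fin ℓ → ℕ) (e : Fin ℓ → Fin ℓ → Bool)
                   (s t : Fin ℓ) (w : ℕ) where

  eH : VH s t → VH s t → Bool
  eH (old i _ _) (old j _ _) = e i j
  eH (old i _ _) u = toU i w
    where
    toU : Fin ℓ → ℕ → Bool
    toU i zero    = e i s ∨ e i t
    toU i (suc _) = e i t
  eH u (old i _ _) with cmp (n s +ℕ w) (n t)
  ... | gt = e s i
  ... | eq = e s i ∨ e t i
  ... | lt = e t i
  eH u u = false

  nH : VH s t → ℕ
  nH u           = ℕ._⊔_ (n s +ℕ w) (n t)
  nH (old i _ _) = n i

-- The map φ with φ(y)_s = y_u + w, φ(y)_t = y_u and φ(y)_i = y_i otherwise is an affine
-- bijection from K^(V^H) onto H. Pulling back along φ, the hyperplanes x_i − x_j = c with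
-- i, j ∉ {s, t} stay as they are, x_i − x_t = c becomes y_i − y_u = c and x_i − x_s = c
-- becomes y_i − y_u = c + w; hyperplanes x_s − x_t = c never survive restriction. So the
-- theorem comes down to integer bookkeeping: for i ∉ {s, t} the constants allowed for
-- y_i − y_u in 𝒜(n^H, G^H) form the interval
--   [ −max(n_i + ε(i,t), n_i + ε(i,s) ∸ w) , max(n_t + ε(t,i), n_s + ε(s,i) + w) ],
-- which is the union of the range of x_i − x_t and the range of x_i − x_s shifted by w;
-- the two ranges touch because w ≤ n_t + ε(t,s). Hyperplanes y_u − y_j reduce to this
-- case by exchanging the two coordinates.

module Submission where

open import Defs
open import Data.Integer using (+_)
open import Data.Bool using (Bool)
open import Data.Fin using (Fin)
open import Data.Product using (Σ; ∃; _×_; _,_)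
open import Relation.Binary.PropositionalEquality using (_≢_)

import Level
open import Data.Nat as ℕ using (zero; suc; _∸_; _⊔_; _<_; s≤s; z<s; s<s)
import Data.Nat.Properties as ℕ
open import Data.Integer as ℤ using (ℤ; -[1+_]; _⊖_; +≤+; -≤+)
import Data.Integer.Properties as ℤ
open import Data.Bool using (true; false; _∨_; if_then_else_)
import Data.Fin as Fin
open import Data.Product using (proj₁; proj₂)
open import Data.Sum using (_⊎_; inj₁; inj₂)
open import Data.Empty using (⊥-elim; ⊥-elim-irr)
open import Relation.Nullary using (¬_; does; yes; no; contradiction)
open import Relation.Nullary.Decidable using (dec-true; dec-false)
open import Relation.Binary.Definitions using (DecidableEquality)
open import Relation.Binary.PropositionalEquality as ≡ using (_≡_; refl)
open import Function using (id)

-- Hyperplanes and affine maps over a field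

module Hyperplanes {k₁ k₂} (K : Field k₁ k₂) where
  open Field K renaming (refl to ≈-refl)
  open FieldOps K
  open import Algebra.Properties.AbelianGroup +-abelianGroup
  open import Algebra.Properties.Loop loop using (x//ε≈x)
  open import Algebra.Properties.CommutativeSemigroup +-commutativeSemigroup using (xy∙z≈xz∙y)
  open import Relation.Binary.Reasoning.Setoid setoid

  natK-homo-+ : ∀ m n → natK (m ℕ.+ n) ≈ natK m + natK n
  natK-homo-+ zero    n = sym (+-identityˡ (natK n))
  natK-homo-+ (suc m) n = trans (+-congˡ (natK-homo-+ m n)) (sym (+-assoc 1# (natK m) (natK n)))

  [x+k]-[y+m]≈[x-y+k]-m : ∀ x y k m → (x + k) - (y + m) ≈ ((x - y) + k) - m
  [x+k]-[y+m]≈[x-y+k]-m x y k m = begin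
    (x + k) - (y + m)      ≈⟨ +-congˡ (⁻¹-∙-comm y m) ⟨
    (x + k) + (- y + - m)  ≈⟨ +-assoc (x + k) (- y) (- m) ⟨
    ((x + k) - y) - m      ≈⟨ +-congʳ (xy∙z≈xz∙y x k (- y)) ⟩
    ((x - y) + k) - m      ∎

  intK-⊖ : ∀ m n → intK (m ⊖ n) ≈ natK m - natK n
  intK-⊖ m zero = sym (x//ε≈x (natK m))
  intK-⊖ zero (suc n) = sym (+-identityˡ _)
  intK-⊖ (suc m) (suc n) = begin
    intK (suc m ⊖ suc n)           ≡⟨ ≡.cong intK (ℤ.[1+m]⊖[1+n]≡m⊖n m n) ⟩
    intK (m ⊖ n)                   ≈⟨ intK-⊖ m n ⟩
    natK m - natK n                ≈⟨ //-rightDividesʳ 1# (natK m - natK n) ⟨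
    ((natK m - natK n) + 1#) - 1#  ≈⟨ [x+k]-[y+m]≈[x-y+k]-m (natK m) (natK n) 1# 1# ⟨
    (natK m + 1#) - (natK n + 1#)  ≈⟨ +-cong (+-comm (natK m) 1#) (-‿cong (+-comm (natK n) 1#)) ⟩
    natK (suc m) - natK (suc n)    ∎

  intK-homo-+ : ∀ i j → intK (i ℤ.+ j) ≈ intK i + intK j
  intK-homo-+ (+ m)    (+ n)    = natK-homo-+ m n
  intK-homo-+ (+ m)    -[1+ n ] = intK-⊖ m (suc n)
  intK-homo-+ -[1+ m ] (+ n)    = trans (intK-⊖ n (suc m)) (+-comm (natK n) _)
  intK-homo-+ -[1+ m ] -[1+ n ] = begin
    - natK (suc (suc (m ℕ.+ n)))     ≡⟨ ≡.cong (λ k → - natK (suc k)) (ℕ.+-suc m n) ⟨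
    - natK (suc m ℕ.+ suc n)         ≈⟨ -‿cong (natK-homo-+ (suc m) (suc n)) ⟩
    - (natK (suc m) + natK (suc n))  ≈⟨ ⁻¹-∙-comm (natK (suc m)) (natK (suc n)) ⟨
    - natK (suc m) + - natK (suc n)  ∎

  intK-homo‿- : ∀ i → intK (ℤ.- i) ≈ - intK i
  intK-homo‿- -[1+ n ] = sym (⁻¹-involutive _)
  intK-homo‿- (+ zero) = sym ε⁻¹≈ε
  intK-homo‿- (+ suc n) = ≈-refl

  x-y≈k⇒y+k≈x : ∀ {x y k} → x - y ≈ k → y + k ≈ x
  x-y≈k⇒y+k≈x {x} {y} {k} x-y≈k = begin
    y + k        ≈⟨ +-comm y k ⟩
    k + y        ≈⟨ +-congʳ x-y≈k ⟨
    (x - y) + y  ≈⟨ //-rightDividesˡ y x ⟩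
    x            ∎

  shift-equation : ∀ {d d′ k m c c′} → d′ ≈ (d + k) - m → c + k ≈ c′ + m →
                   (d ≈ c → d′ ≈ c′) × (d′ ≈ c′ → d ≈ c)
  shift-equation {d} {d′} {k} {m} {c} {c′} d′≈ c+k≈c′+m =
    (λ d≈c → begin
      d′             ≈⟨ d′≈ ⟩
      (d + k) - m    ≈⟨ +-congʳ (+-congʳ d≈c) ⟩
      (c + k) - m    ≈⟨ +-congʳ c+k≈c′+m ⟩
      (c′ + m) - m   ≈⟨ //-rightDividesʳ m c′ ⟩
      c′             ∎) ,
    (λ d′≈c′ → ∙-cancelʳ k d c (begin
      d + k            ≈⟨ //-rightDividesˡ m (d + k) ⟨
      (d + k) - m + m  ≈⟨ +-congʳ d′≈ ⟨
      d′ + m           ≈⟨ +-congʳ d′≈c′ ⟩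
      c′ + m           ≈⟨ c+k≈c′+m ⟨
      c + k            ∎))

  ∈H-swap : ∀ {V : Set} (x : V → Carrier) {i j} c → x ∈H (i , j , c) → x ∈H (j , i , ℤ.- c)
  ∈H-swap x {i} {j} c x∈H = begin
    x j - x i      ≈⟨ ⁻¹-anti-homo‿- (x i) (x j) ⟨
    - (x i - x j)  ≈⟨ -‿cong x∈H ⟩
    - intK c       ≈⟨ intK-homo‿- c ⟨
    intK (ℤ.- c)   ∎

  ∈H-unswap : ∀ {V : Set} (x : V → Carrier) {i j} c → x ∈H (j , i , ℤ.- c) → x ∈H (i , j , c)
  ∈H-unswap x {i} {j} c x∈H =
    ≡.subst (λ c′ → x ∈H (i , j , c′)) (ℤ.neg-involutive c) (∈H-swap x (ℤ.- c) x∈H)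

  Pullback-swap : ∀ {W V : Set} {φ : (W → Carrier) → (V → Carrier)} {a b c i j c′} →
                  Pullback φ (a , b , c) (i , j , c′) → Pullback φ (b , a , ℤ.- c) (j , i , ℤ.- c′)
  Pullback-swap {φ = φ} {c = c} {c′ = c′} pb y =
    (λ y∈H″ → ∈H-swap (φ y) c′ (proj₁ (pb y) (∈H-unswap y c y∈H″))) ,
    (λ φy∈H′ → ∈H-swap y c (proj₂ (pb y) (∈H-unswap (φ y) c′ φy∈H′)))

  Survives-swap : ∀ {V : Set} {H : HP V} {i j c} → Survives H (i , j , c) → Survives H (j , i , ℤ.- c)
  Survives-swap {c = c} (H⊈H′ , z , z∈H , z∈H′) =
    (λ H⊆ → H⊈H′ (λ x x∈H → ∈H-unswap x c (H⊆ x x∈H))) , z , z∈H , ∈H-swap z c z∈H′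

  ¬Survives-parallel : ∀ {V : Set} {s t : V} {c c′} → ¬ Survives (s , t , c) (s , t , c′)
  ¬Survives-parallel (H⊈H′ , z , z∈H , z∈H′) =
    H⊈H′ (λ x x∈H → trans x∈H (trans (sym z∈H) z∈H′))

  spike : ∀ {W : Set} → DecidableEquality W → W → Carrier → W → Carrier
  spike _≟_ a r v = if does (a ≟ v) then r else 0#

  spike-difference : ∀ {W : Set} (_≟_ : DecidableEquality W) {a b} → a ≢ b → ∀ r →
                     spike _≟_ a r a - spike _≟_ a r b ≈ r
  spike-difference _≟_ {a} {b} a≢b r = begin
    spike _≟_ a r a - spike _≟_ a r b
      ≡⟨ ≡.cong₂ (λ d d′ → (if d then r else 0#) - (if d′ then r else 0#))
                 (dec-true (a ≟ a) ≡.refl) (dec-false (a ≟ b) a≢b) ⟩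
    r - 0#
      ≈⟨ x//ε≈x r ⟩
    r ∎

  Pullback⇒Survives : ∀ {W V : Set} → DecidableEquality W →
                      {φ : (W → Carrier) → (V → Carrier)} {H : HP V} → (∀ y → φ y ∈H H) →
                      ∀ {a b c H′} → a ≢ b → Pullback φ (a , b , c) H′ → Survives H H′
  Pullback⇒Survives {W} _≟_ {φ} {H} φ⊆H {a} {b} {c} {H′} a≢b pb =
    H⊈H′ , φ y₀ , φ⊆H y₀ , proj₁ (pb y₀) (spike-difference _≟_ a≢b (intK c))
    where
    y₀ y₁ : W → Carrier
    y₀ = spike _≟_ a (intK c)
    y₁ = spike _≟_ a (intK c + 1#)
    H⊈H′ : ¬ (∀ z → z ∈H H → z ∈H H′)
    H⊈H′ H⊆H′ = 1≉0 (identityʳ-unique (intK c) 1# (begin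
      intK c + 1#  ≈⟨ spike-difference _≟_ a≢b (intK c + 1#) ⟨
      y₁ a - y₁ b  ≈⟨ proj₂ (pb y₁) (H⊆H′ (φ y₁) (φ⊆H y₁)) ⟩
      intK c       ∎))

  reindex : ∀ {V W : Set} → (V → W × ℤ) → (W → Carrier) → (V → Carrier)
  reindex f y k = y (proj₁ (f k)) + intK (proj₂ (f k))

  reindex-affine : ∀ {V W : Set} (f : V → W × ℤ) → IsAffine (reindex f)
  reindex-affine {V} f = offset , congruent , additive , homogeneous
    where
    offset : V → Carrier
    offset k = intK (proj₂ (f k))
    untranslate : ∀ y k → reindex f y k - offset k ≈ y (proj₁ (f k))
    untranslate y k = //-rightDividesʳ (offset k) (y (proj₁ (f k)))
    congruent : ∀ x y → x ≈ᵥ y →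
                (λ k → reindex f x k - offset k) ≈ᵥ (λ k → reindex f y k - offset k)
    congruent x y x≈y k = +-congʳ (+-congʳ (x≈y (proj₁ (f k))))
    additive : ∀ x y → (λ k → reindex f (λ v → x v + y v) k - offset k)
                     ≈ᵥ (λ k → (reindex f x k - offset k) + (reindex f y k - offset k))
    additive x y k =
      trans (untranslate (λ v → x v + y v) k) (sym (+-cong (untranslate x k) (untranslate y k)))
    homogeneous : ∀ r x → (λ k → reindex f (λ v → r * x v) k - offset k)
                        ≈ᵥ (λ k → r * (reindex f x k - offset k))
    homogeneous r x k = trans (untranslate (λ v → r * x v) k) (sym (*-congˡ (untranslate x k)))

  reindex-injective : ∀ {V W : Set} (f : V → W × ℤ) → (∀ v → ∃ λ k → proj₁ (f k) ≡ v) →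
                      ∀ x y → reindex f x ≈ᵥ reindex f y → x ≈ᵥ y
  reindex-injective f f-onto x y fx≈fy v with f-onto v
  ... | k , ≡.refl = ∙-cancelʳ (intK (proj₂ (f k))) _ _ (fx≈fy k)

  reindex-pullback : ∀ {V W : Set} (f : V → W × ℤ) {i j a b k m} c c′ →
                     f i ≡ (a , k) → f j ≡ (b , m) → c ℤ.+ k ≡ c′ ℤ.+ m →
                     Pullback (reindex f) (a , b , c) (i , j , c′)
  reindex-pullback {W = W} f {i} {j} {a} {b} {k} {m} c c′ fi fj c+k≡c′+m y =
    shift-equation difference (begin
      intK c + intK k   ≈⟨ intK-homo-+ c k ⟨
      intK (c ℤ.+ k)    ≡⟨ ≡.cong intK c+k≡c′+m ⟩
      intK (c′ ℤ.+ m)   ≈⟨ intK-homo-+ c′ m ⟩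
      intK c′ + intK m  ∎)
    where
    difference : reindex f y i - reindex f y j ≈ ((y a - y b) + intK k) - intK m
    difference = trans (reflexive (≡.cong₂ (λ p q → reindex-at p - reindex-at q) fi fj))
                       ([x+k]-[y+m]≈[x-y+k]-m (y a) (y b) (intK k) (intK m))
      where
      reindex-at : W × ℤ → Carrier
      reindex-at p = y (proj₁ p) + intK (proj₂ p)

open import Data.Nat using (ℕ; _+_; _≤_)
open import Relation.Binary.PropositionalEquality using (sym; trans; cong; cong₂; subst)
open import Algebra.Properties.CommutativeSemigroup ℕ.+-commutativeSemigroup using (xy∙z≈xz∙y)
import Algebra.Properties.AbelianGroup ℤ.+-0-abelianGroup as ℤ-group

-- Integer intervals

Within : ℕ → ℕ → ℤ → Set
Within L U c = ℤ.- (+ L) ℤ.≤ c × c ℤ.≤ + U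

-L≤-[1+m]⇒1+m≤L : ∀ {L m} → ℤ.- (+ L) ℤ.≤ -[1+ m ] → suc m ≤ L
-L≤-[1+m]⇒1+m≤L lo = ℤ.drop‿+≤+ (ℤ.neg-cancel-≤ lo)

1+m≤L⇒-L≤-[1+m] : ∀ {L m} → suc m ≤ L → ℤ.- (+ L) ℤ.≤ -[1+ m ]
1+m≤L⇒-L≤-[1+m] sm≤L = ℤ.neg-mono-≤ (+≤+ sm≤L)

Within-mono : ∀ {L L′ U U′ c} → L ≤ L′ → U ≤ U′ → Within L U c → Within L′ U′ c
Within-mono L≤L′ U≤U′ (lo , hi) =
  ℤ.≤-trans (ℤ.neg-mono-≤ (+≤+ L≤L′)) lo , ℤ.≤-trans hi (+≤+ U≤U′)

Within-neg : ∀ {L U c} → Within L U c → Within U L (ℤ.- c)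
Within-neg {L} {c = c} (lo , hi) =
  ℤ.neg-mono-≤ hi , subst (ℤ.- c ℤ.≤_) (ℤ.neg-involutive (+ L)) (ℤ.neg-mono-≤ lo)

m≤n⊔o∧m≰n⇒m≤o : ∀ {m n o} → m ≤ n ⊔ o → ¬ m ≤ n → m ≤ o
m≤n⊔o∧m≰n⇒m≤o {m} {n} {o} m≤n⊔o m≰n with ℕ.⊔-sel n o
... | inj₁ n⊔o≡n = contradiction (subst (m ≤_) n⊔o≡n m≤n⊔o) m≰n
... | inj₂ n⊔o≡o = subst (m ≤_) n⊔o≡o m≤n⊔o

-[k∸w]≤w⊖k : ∀ k w → ℤ.- (+ (k ∸ w)) ℤ.≤ w ⊖ k
-[k∸w]≤w⊖k k w with ℕ.≤-total w k
... | inj₁ w≤k = ℤ.≤-reflexive (sym (ℤ.⊖-≤ w≤k))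
... | inj₂ k≤w = subst (ℤ.- (+ (k ∸ w)) ℤ.≤_) (sym (ℤ.⊖-≥ k≤w)) ℤ.neg-≤-pos

Within-shift : ∀ {L U c} w → Within L U c → Within (L ∸ w) (U + w) (c ℤ.+ + w)
Within-shift {L} {U} {+ m} w (_ , +≤+ m≤U) = ℤ.neg-≤-pos , +≤+ (ℕ.+-monoˡ-≤ w m≤U)
Within-shift {L} {U} { -[1+ m ]} w (lo , _) =
  ℤ.≤-trans (ℤ.neg-mono-≤ (+≤+ (ℕ.∸-monoˡ-≤ w (-L≤-[1+m]⇒1+m≤L lo)))) (-[k∸w]≤w⊖k (suc m) w) ,
  ℤ.≤-trans (ℤ.m⊖n≤m w (suc m)) (+≤+ (ℕ.m≤n+m w U))

Within-split : ∀ {Lt Ut Ls Us w c} → w ≤ suc Ut →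
  Within (Lt ⊔ (Ls ∸ w)) (Ut ⊔ (Us + w)) c → Within Lt Ut c ⊎ Within Ls Us (c ℤ.- + w)
Within-split {Lt} {Ut} {Ls} {Us} {w} {+ m} w≤1+Ut (_ , +≤+ m≤max) with m ℕ.≤? Ut
... | yes m≤Ut = inj₁ (ℤ.neg-≤-pos , +≤+ m≤Ut)
... | no m≰Ut = inj₂ (subst (Within Ls Us) (sym +m-w≡+[m∸w])
        (ℤ.neg-≤-pos , +≤+ (ℕ.m≤n+o⇒m∸n≤o m w (subst (m ≤_) (ℕ.+-comm Us w) m≤Us+w))))
  where
  m≤Us+w : m ≤ Us + w
  m≤Us+w = m≤n⊔o∧m≰n⇒m≤o m≤max m≰Ut
  +m-w≡+[m∸w] : + m ℤ.- + w ≡ + (m ∸ w)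
  +m-w≡+[m∸w] = trans (ℤ.m-n≡m⊖n m w) (ℤ.⊖-≥ (ℕ.≤-trans w≤1+Ut (ℕ.≰⇒> m≰Ut)))
Within-split {Lt} {Ut} {Ls} {Us} {w} { -[1+ m ]} _ (lo , _) with suc m ℕ.≤? Lt
... | yes 1+m≤Lt = inj₁ (1+m≤L⇒-L≤-[1+m] 1+m≤Lt , -≤+)
... | no 1+m≰Lt = inj₂ (subst (Within Ls Us) (ℤ.neg-distrib-+ (+ suc m) (+ w))
        (ℤ.neg-mono-≤ (+≤+ 1+m+w≤Ls) , ℤ.neg-≤-pos))
  where
  1+m≤Ls∸w : suc m ≤ Ls ∸ w
  1+m≤Ls∸w = m≤n⊔o∧m≰n⇒m≤o (-L≤-[1+m]⇒1+m≤L lo) 1+m≰Lt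
  1+m+w≤Ls : suc m + w ≤ Ls
  1+m+w≤Ls = ℕ.m≤o∸n⇒m+n≤o (suc m) (ℕ.<⇒≤ w<Ls) 1+m≤Ls∸w
    where
    w<Ls : w < Ls
    w<Ls = ℕ.m∸n≢0⇒n<m (ℕ.>⇒≢ (ℕ.<-≤-trans z<s 1+m≤Ls∸w))

-- Bounds in the contracted graph

indicator : Bool → ℕ
indicator b = if b then 1 else 0

m+indicator≤1+m : ∀ m b → m + indicator b ≤ suc m
m+indicator≤1+m m true  = ℕ.≤-reflexive (ℕ.+-comm m 1)
m+indicator≤1+m m false = ℕ.≤-trans (ℕ.≤-reflexive (ℕ.+-identityʳ m)) (ℕ.n≤1+n m)

indicator-∨ : ∀ x y → indicator (x ∨ y) ≡ indicator y ⊔ indicator x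
indicator-∨ true  true  = refl
indicator-∨ true  false = refl
indicator-∨ false true  = refl
indicator-∨ false false = refl

⊔-indicator-> : ∀ {m n} x y → n < m → (m ⊔ n) + indicator x ≡ (n + indicator y) ⊔ (m + indicator x)
⊔-indicator-> {m} {n} x y n<m = begin
  (m ⊔ n) + indicator x                  ≡⟨ cong (_+ indicator x) (ℕ.m≥n⇒m⊔n≡m (ℕ.<⇒≤ n<m)) ⟩
  m + indicator x                        ≡⟨ ℕ.m≤n⇒m⊔n≡n n+y≤m+x ⟨
  (n + indicator y) ⊔ (m + indicator x)  ∎
  where
  open ≡.≡-Reasoning
  n+y≤m+x : n + indicator y ≤ m + indicator x
  n+y≤m+x = ℕ.≤-trans (m+indicator≤1+m n y) (ℕ.≤-trans n<m (ℕ.m≤m+n m (indicator x)))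

⊔-indicator-≡ : ∀ {m n} x y → m ≡ n →
                (m ⊔ n) + indicator (x ∨ y) ≡ (n + indicator y) ⊔ (m + indicator x)
⊔-indicator-≡ {m} x y refl = begin
  (m ⊔ m) + indicator (x ∨ y)              ≡⟨ cong₂ _+_ (ℕ.⊔-idem m) (indicator-∨ x y) ⟩
  m + (indicator y ⊔ indicator x)          ≡⟨ ℕ.+-distribˡ-⊔ m (indicator y) (indicator x) ⟩
  (m + indicator y) ⊔ (m + indicator x)    ∎
  where open ≡.≡-Reasoning

⊔-indicator-< : ∀ {m n} x y → m < n → (m ⊔ n) + indicator y ≡ (n + indicator y) ⊔ (m + indicator x)
⊔-indicator-< {m} {n} x y m<n = begin
  (m ⊔ n) + indicator y                  ≡⟨ cong (_+ indicator y) (ℕ.m≤n⇒m⊔n≡n (ℕ.<⇒≤ m<n)) ⟩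
  n + indicator y                        ≡⟨ ℕ.m≥n⇒m⊔n≡m m+x≤n+y ⟨
  (n + indicator y) ⊔ (m + indicator x)  ∎
  where
  open ≡.≡-Reasoning
  m+x≤n+y : m + indicator x ≤ n + indicator y
  m+x≤n+y = ℕ.≤-trans (m+indicator≤1+m m x) (ℕ.≤-trans m<n (ℕ.m≤m+n n (indicator y)))

data CmpView (m n : ℕ) : Cmp → Set where
  greater : n < m → CmpView m n gt
  equal   : m ≡ n → CmpView m n eq
  less    : m < n → CmpView m n lt

cmp-view : ∀ m n → CmpView m n (cmp m n)
cmp-view zero    zero    = equal refl
cmp-view zero    (suc n) = less z<s
cmp-view (suc m) zero    = greater z<s
cmp-view (suc m) (suc n) with cmp m n | cmp-view m n
... | gt | greater n<m = greater (s<s n<m)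
... | eq | equal m≡n   = equal (cong suc m≡n)
... | lt | less m<n    = less (s<s m<n)

-- InArr n e (i , j , c) unfolds to i ≢ j × Within (bound n e i j) (bound n e j i) c.
bound : {V : Set} → (V → ℕ) → (V → V → Bool) → V → V → ℕ
bound n e i j = n i + ε e i j

InArr-swap : ∀ {V : Set} {n : V → ℕ} {e i j c} → InArr n e (i , j , c) → InArr n e (j , i , ℤ.- c)
InArr-swap (i≢j , within) = (λ j≡i → i≢j (sym j≡i)) , Within-neg within

module ContractionBounds {ℓ : ℕ} (n : Fin ℓ → ℕ) (e : Fin ℓ → Fin ℓ → Bool) (s t : Fin ℓ) where
  open Contraction n e s t

  bound-old-u : ∀ w i .p .q → bound (nH w) (eH w) (old i p q) u ≡ bound n e i t ⊔ (bound n e i s ∸ w)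
  bound-old-u zero i p q =
    trans (cong (λ k → n i + k) (indicator-∨ (e i s) (e i t))) (ℕ.+-distribˡ-⊔ (n i) _ _)
  bound-old-u (suc w) i p q = sym (ℕ.m≥n⇒m⊔n≡m (ℕ.≤-trans [n+x]∸[1+w]≤n (ℕ.m≤m+n (n i) _)))
    where
    [n+x]∸[1+w]≤n : bound n e i s ∸ suc w ≤ n i
    [n+x]∸[1+w]≤n = ℕ.m≤n+o⇒m∸n≤o (bound n e i s) (suc w)
      (ℕ.≤-trans (m+indicator≤1+m (n i) (e i s)) (s≤s (ℕ.m≤n+m (n i) w)))

  bound-u-old : ∀ w i .p .q → bound (nH w) (eH w) u (old i p q) ≡ bound n e t i ⊔ (bound n e s i + w)
  bound-u-old w i p q =
    trans (bound-u-old′ w i p q) (cong (bound n e t i ⊔_) (xy∙z≈xz∙y (n s) w (ε e s i)))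
    where
    bound-u-old′ : ∀ w i .p .q → bound (nH w) (eH w) u (old i p q) ≡ bound n e t i ⊔ ((n s + w) + ε e s i)
    bound-u-old′ w i p q with cmp (n s + w) (n t) | cmp-view (n s + w) (n t)
    ... | gt | greater nt<ns+w  = ⊔-indicator-> (e s i) (e t i) nt<ns+w
    ... | eq | equal ns+w≡nt    = ⊔-indicator-≡ (e s i) (e t i) ns+w≡nt
    ... | lt | less ns+w<nt     = ⊔-indicator-< (e s i) (e t i) ns+w<nt

-- The restriction map

relevant : ∀ {A : Set} {x y : A} → .(x ≢ y) → x ≢ y
relevant x≢y x≡y = ⊥-elim-irr (x≢y x≡y)

_≟ᵥ_ : ∀ {ℓ} {s t : Fin ℓ} → DecidableEquality (VH s t)
u         ≟ᵥ u         = yes refl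
u         ≟ᵥ old _ _ _ = no (λ ())
old _ _ _ ≟ᵥ u         = no (λ ())
old i _ _ ≟ᵥ old j _ _ with i Fin.≟ j
... | yes refl = yes refl
... | no i≢j   = no (λ { refl → i≢j refl })

module Restriction {k₁ k₂} (K : Field k₁ k₂) {ℓ : ℕ} (n : Fin ℓ → ℕ) (e : Fin ℓ → Fin ℓ → Bool)
                   (s t : Fin ℓ) (w : ℕ) (s≢t : s ≢ t) (w≤n+ε : w ≤ n t + ε e t s) where
  open Field K using (Carrier; _≈_; +-identityʳ; -‿inverseʳ)
  open FieldOps K
  open Hyperplanes K
  open Contraction n e s t w
  open ContractionBounds n e s t

  H : HP (Fin ℓ)
  H = s , t , + w

  data Position (k : Fin ℓ) : Set where
    at-s  : k ≡ s → Position k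
    at-t  : k ≡ t → Position k
    other : k ≢ s → k ≢ t → Position k

  position : ∀ k → Position k
  position k with k Fin.≟ s | k Fin.≟ t
  ... | yes k≡s | _       = at-s k≡s
  ... | no _    | yes k≡t = at-t k≡t
  ... | no k≢s  | no k≢t  = other k≢s k≢t

  -- φ = reindex collapse is the map x_s = y_u + w, x_t = y_u, x_i = y_i.
  collapse : Fin ℓ → VH s t × ℤ
  collapse k with position k
  ... | at-s _        = u , + w
  ... | at-t _        = u , + 0
  ... | other k≢s k≢t = old k k≢s k≢t , + 0

  collapse-s : collapse s ≡ (u , + w)
  collapse-s with position s
  ... | at-s _      = refl
  ... | at-t s≡t    = ⊥-elim (s≢t s≡t)
  ... | other s≢s _ = ⊥-elim (s≢s refl)

  collapse-t : collapse t ≡ (u , + 0)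
  collapse-t with position t
  ... | at-s t≡s    = ⊥-elim (s≢t (sym t≡s))
  ... | at-t _      = refl
  ... | other _ t≢t = ⊥-elim (t≢t refl)

  collapse-old : ∀ i .p .q → collapse i ≡ (old i p q , + 0)
  collapse-old i p q with position i
  ... | at-s i≡s  = ⊥-elim-irr (p i≡s)
  ... | at-t i≡t  = ⊥-elim-irr (q i≡t)
  ... | other _ _ = refl

  lift : VH s t → Fin ℓ
  lift u           = t
  lift (old i _ _) = i

  collapse-lift : ∀ v → proj₁ (collapse (lift v)) ≡ v
  collapse-lift u           = cong proj₁ collapse-t
  collapse-lift (old i p q) = cong proj₁ (collapse-old i p q)

  φ : (VH s t → Carrier) → (Fin ℓ → Carrier)
  φ = reindex collapse

  -- The degenerate hyperplane y_u − y_u = 0 is all of K^(V^H), and it pulls back to H.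
  φ-into-H : ∀ y → φ y ∈H H
  φ-into-H y =
    proj₁ (reindex-pullback collapse (+ 0) (+ w) collapse-s collapse-t (ℤ.+-comm (+ 0) (+ w)) y)
          (-‿inverseʳ (y u))

  φ-onto-H : ∀ z → z ∈H H → ∃ λ x → φ x ≈ᵥ z
  φ-onto-H z z∈H = (λ v → z (lift v)) , agrees
    where
    agrees : ∀ k → φ (λ v → z (lift v)) k ≈ z k
    agrees k with position k
    ... | at-s refl = x-y≈k⇒y+k≈x z∈H
    ... | at-t refl = +-identityʳ (z t)
    ... | other _ _ = +-identityʳ (z k)

  old-old-pullback : ∀ {i j} .{p q p′ q′} c → Pullback φ (old i p q , old j p′ q′ , c) (i , j , c)
  old-old-pullback {i} {j} c = reindex-pullback collapse c c (collapse-old i _ _) (collapse-old j _ _) refl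

  old-t-pullback : ∀ {i} .{p q} c → Pullback φ (old i p q , u , c) (i , t , c)
  old-t-pullback {i} c = reindex-pullback collapse c c (collapse-old i _ _) collapse-t refl

  old-s-pullback : ∀ {i} .{p q} c c′ → c ℤ.+ + 0 ≡ c′ ℤ.+ + w →
                   Pullback φ (old i p q , u , c) (i , s , c′)
  old-s-pullback {i} c c′ = reindex-pullback collapse c c′ (collapse-old i _ _) collapse-s

  Matched : HP (VH s t) → HP (Fin ℓ) → Set (k₁ Level.⊔ k₂)
  Matched H″ H′ = InArr nH eH H″ × InArr n e H′ × Pullback φ H″ H′

  Matched-swap : ∀ {a b c i j c′} →
                 Matched (a , b , c) (i , j , c′) → Matched (b , a , ℤ.- c) (j , i , ℤ.- c′)
  Matched-swap {a} {b} {c} {i} {j} {c′} (H″∈𝒜 , H′∈𝒜 , pullback) =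
    InArr-swap {n = nH} {e = eH} H″∈𝒜 ,
    InArr-swap {n = n} {e = e} H′∈𝒜 ,
    Pullback-swap {φ = φ} {a} {b} {c} {i} {j} {c′} pullback

  old-u-bounds : ∀ i .p .q c →
    Within (bound nH eH (old i p q) u) (bound nH eH u (old i p q)) c ≡
    Within (bound n e i t ⊔ (bound n e i s ∸ w)) (bound n e t i ⊔ (bound n e s i + w)) c
  old-u-bounds i p q c = cong₂ (λ L U → Within L U c) (bound-old-u w i p q) (bound-u-old w i p q)

  w≤1+bound : ∀ i → w ≤ suc (bound n e t i)
  w≤1+bound i = ℕ.≤-trans w≤n+ε (ℕ.≤-trans (m+indicator≤1+m (n t) (e t s)) (s≤s (ℕ.m≤m+n (n t) _)))

  match-restricted-old-u : ∀ i .p .q c → InArr nH eH (old i p q , u , c) →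
                           ∃ λ H′ → Matched (old i p q , u , c) H′
  match-restricted-old-u i p q c H″∈𝒜
    with Within-split (w≤1+bound i) (subst id (old-u-bounds i p q c) (proj₂ H″∈𝒜))
  ... | inj₁ within-t = (i , t , c) , H″∈𝒜 , (relevant q , within-t) , old-t-pullback c
  ... | inj₂ within-s = (i , s , c ℤ.- + w) , H″∈𝒜 , (relevant p , within-s) ,
                        old-s-pullback c (c ℤ.- + w)
                          (trans (ℤ.+-identityʳ c) (sym (ℤ-group.//-rightDividesˡ (+ w) c)))

  match-restricted : ∀ H″ → InArr nH eH H″ → ∃ λ H′ → Matched H″ H′
  match-restricted (u , u , c) (u≢u , _) = ⊥-elim (u≢u refl)
  match-restricted (old i p q , u , c) H″∈𝒜 = match-restricted-old-u i p q c H″∈𝒜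
  match-restricted (u , old j p q , c) H″∈𝒜
    with match-restricted-old-u j p q (ℤ.- c) (InArr-swap {n = nH} {e = eH} H″∈𝒜)
  ... | (k , l , c′) , matched =
    (l , k , ℤ.- c′) ,
    subst (λ c″ → Matched (u , old j p q , c″) (l , k , ℤ.- c′)) (ℤ.neg-involutive c) (Matched-swap matched)
  match-restricted (old i p q , old j p′ q′ , c) (old≢old , within) =
    (i , j , c) , (old≢old , within) , ((λ { refl → old≢old refl }) , within) , old-old-pullback c

  match-original-old : ∀ i .p .q {j c} → Position j → InArr n e (i , j , c) →
                       ∃ λ H″ → Matched H″ (i , j , c)
  match-original-old i p q {c = c} (at-s refl) (i≢s , within) =
    (old i p q , u , c ℤ.+ + w) ,
    ((λ ()) , subst id (sym (old-u-bounds i p q (c ℤ.+ + w)))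
                (Within-mono (ℕ.m≤n⊔m _ _) (ℕ.m≤n⊔m _ _) (Within-shift w within))) ,
    (i≢s , within) , old-s-pullback (c ℤ.+ + w) c (ℤ.+-identityʳ _)
  match-original-old i p q {c = c} (at-t refl) (i≢t , within) =
    (old i p q , u , c) ,
    ((λ ()) , subst id (sym (old-u-bounds i p q c))
                (Within-mono (ℕ.m≤m⊔n _ _) (ℕ.m≤m⊔n _ _) within)) ,
    (i≢t , within) , old-t-pullback c
  match-original-old i p q {j} {c} (other p′ q′) (i≢j , within) =
    (old i p q , old j p′ q′ , c) , ((λ { refl → i≢j refl }) , within) , (i≢j , within) , old-old-pullback c

  match-original : ∀ H′ → InArr n e H′ → Survives H H′ → ∃ λ H″ → Matched H″ H′
  match-original (i , j , c) = by-position (position i) (position j)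
    where
    by-position : Position i → Position j → InArr n e (i , j , c) → Survives H (i , j , c) →
                  ∃ λ H″ → Matched H″ (i , j , c)
    by-position (other p q) position-j H′∈𝒜 _ = match-original-old i p q position-j H′∈𝒜
    by-position (at-s refl) (at-s refl) H′∈𝒜 _ = ⊥-elim (proj₁ H′∈𝒜 refl)
    by-position (at-t refl) (at-t refl) H′∈𝒜 _ = ⊥-elim (proj₁ H′∈𝒜 refl)
    by-position (at-s refl) (at-t refl) _ H′-survives =
      ⊥-elim (¬Survives-parallel {c = + w} {c′ = c} H′-survives)
    by-position (at-t refl) (at-s refl) _ H′-survives =
      ⊥-elim (¬Survives-parallel {c = + w} {c′ = ℤ.- c} (Survives-swap {H = H} {c = c} H′-survives))
    by-position position-i (other p q) H′∈𝒜 _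
      with match-original-old j p q position-i (InArr-swap {n = n} {e = e} H′∈𝒜)
    ... | (a′ , b′ , c″) , matched =
      (b′ , a′ , ℤ.- c″) ,
      subst (λ c‴ → Matched (b′ , a′ , ℤ.- c″) (i , j , c‴)) (ℤ.neg-involutive c) (Matched-swap matched)

  restricted⇒original : ∀ H″ → InArr nH eH H″ →
                        ∃ λ H′ → InArr n e H′ × Survives H H′ × Pullback φ H″ H′
  restricted⇒original (a′ , b′ , c) H″∈𝒜 with match-restricted (a′ , b′ , c) H″∈𝒜
  ... | H′ , _ , H′∈𝒜 , pullback =
    H′ , H′∈𝒜 ,
    Pullback⇒Survives _≟ᵥ_ {H = H} φ-into-H {c = c} {H′ = H′} (proj₁ H″∈𝒜) pullback ,
    pullback

  original⇒restricted : ∀ H′ → InArr n e H′ → Survives H H′ →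
                        ∃ λ H″ → InArr nH eH H″ × Pullback φ H″ H′
  original⇒restricted H′ H′∈𝒜 H′-survives with match-original H′ H′∈𝒜 H′-survives
  ... | H″ , H″∈𝒜 , _ , pullback = H″ , H″∈𝒜 , pullback

theorem2p5 : ∀ {a b} (K : Field a b) → FieldOps.CharZero K →
    (ℓ : ℕ) → 2 ≤ ℓ →
    (e : Fin ℓ → Fin ℓ → Bool) (n : Fin ℓ → ℕ) (s t : Fin ℓ) (w : ℕ) →
    s ≢ t → w ≤ n t + ε e t s →
    let open FieldOps K
        open Contraction n e s t w
        H = (s , t , + w)
    in Σ ((VH s t → Field.Carrier K) → (Fin ℓ → Field.Carrier K)) λ φ →
         IsAffine φ
       × (∀ x y → φ x ≈ᵥ φ y → x ≈ᵥ y)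
       × (∀ x → φ x ∈H H)
       × (∀ z → z ∈H H → ∃ λ x → φ x ≈ᵥ z)
       × (∀ H'' → InArr nH eH H'' →
            ∃ λ H' → InArr n e H' × Survives H H' × Pullback φ H'' H')
       × (∀ H' → InArr n e H' → Survives H H' →
            ∃ λ H'' → InArr nH eH H'' × Pullback φ H'' H')
theorem2p5 K _ ℓ _ e n s t w s≢t w≤n+ε =
  φ , reindex-affine collapse , reindex-injective collapse (λ v → lift v , collapse-lift v) ,
  φ-into-H , φ-onto-H , restricted⇒original , original⇒restricted
  where
  open Hyperplanes K
  open Restriction K n e s t w s≢t w≤n+ε
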